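{- Let $p$ be a prime, let $P\in p\uparrow$ with $P>1$, let $N\in P\uparrow$, and let $S,T\in[0,N)$. Put $R:=(S+T+1)N+T+1$. Then $$\tau_p(S,T)=0\iff N^2 \text{ divides } \binom{P\frac{N-1}{P-1}R}{\frac{N-1}{P-1}R}.$$
   Context: For a positive integer $q$, $q\uparrow:=\{q^n: n\in\mathbb{N}\}$. For integers $c,d$, $[c,d):=\{m\in\mathbb{Z}: c\le m<d\}$. For an integer $p>1$ and $a,b\in\mathbb{N}$, $\tau_p(a,b)$ denotes the number of carries occurring in the addition of $a$ and $b$ in base $p$. -}

module Defs where

open import Data.Nat using (ℕ; zero; suc; _+_; _*_; _^_; _≤ᵇ_; _/_; _%_; NonZero)
open import Data.Bool using (if_then_else_)
open import Data.Product using (Σ)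
open import Relation.Binary.PropositionalEquality using (_≡_)

-- Schoolbook addition of a and b in base p (p ≥ 1), with incoming carry c
-- (0 or 1): at each digit position the digit sum is
-- (a mod p) + (b mod p) + c; a carry occurs iff this sum is ≥ p.
-- We count the carries. 'fuel' only ensures termination; a + b + 1 steps
-- always suffice (after that many positions a = b = 0 and no carry remains).
carriesAux : ℕ → (p : ℕ) → .{{_ : NonZero p}} → ℕ → ℕ → ℕ → ℕ
carriesAux zero       p c a b = 0
carriesAux (suc fuel) p c a b =
  if p ≤ᵇ (a % p + b % p + c)
  then suc (carriesAux fuel p 1 (a / p) (b / p))
  else carriesAux fuel p 0 (a / p) (b / p)

-- τ p a b : number of carries occurring in the addition of a and b in base p.
-- (For p = 0 the value is irrelevant; the paper only uses p > 1.)
τ : ℕ → ℕ → ℕ → ℕ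
τ zero    a b = 0
τ (suc q) a b = carriesAux (suc (a + b)) (suc q) 0 a b

_∈↑_ : ℕ → ℕ → Set
x ∈↑ q = Σ ℕ (λ n → x ≡ q ^ n)

module Submission where

-- Write L(n) = Σᵢ ⌊n/pⁱ⌋ for Legendre's sum, so that v_p(n!) = L(n) and, by Kummer's theorem,
-- v_p(C(a + b, a)) = τ_p(a, b) = L(a + b) − L(a) − L(b). Since KR + (N − 1)R = P·KR, the binomial
-- coefficient has valuation τ_p(KR, (N − 1)R) = (N − 1)/(p − 1)·R − L((N − 1)R), using
-- L(pʲy + z) = y(pʲ − 1)/(p − 1) + L(y) + L(z) for z < pʲ. With N = pⁿ, A = N − 1 − S and
-- B = N − 1 − T, the number (N − 1)R has base-N digits S + T, A, B, and digitwise complements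
-- satisfy L(S) + L(A) = L(T) + L(B) = (N − 1)/(p − 1) − n. Collecting terms gives
-- τ_p(KR, (N − 1)R) + τ_p(S, T) = 2n, so N² = p²ⁿ divides the coefficient iff τ_p(S, T) = 0.

open import Defs
open import Data.Nat using (ℕ; zero; suc; _+_; _*_; _∸_; _<_; _≤_; _^_; _/_; _%_; _<?_; z≤n; s≤s; _≤ᵇ_; _!; ≢-nonZero⁻¹)
open import Data.Nat.Properties
open import Data.Nat.DivMod
open import Data.Nat.Divisibility using (_∣_; _∣?_; divides; n∣m*n; m∣m*n; _∣0; ∣1⇒≡1)
open import Data.Nat.Primality using (Prime; euclidsLemma; ¬prime[0]; ¬prime[1])
open import Data.Nat.Combinatorics using (_C_; nCk≡n!/k![n-k]!; k![n∸k]!∣n!)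
open import Data.Nat.Induction using (<-rec)
open import Data.Bool using (true; false; T; if_then_else_)
open import Data.Product using (∃; _,_; proj₁; proj₂)
open import Data.Sum using (inj₁; inj₂)
open import Function.Bundles using (_⇔_; mk⇔)
open import Data.Empty using (⊥-elim)
open import Relation.Nullary using (¬_; yes; no)
open import Relation.Binary.PropositionalEquality
open import Data.Nat.Tactic.RingSolver using (solve-∀)

-- The base p is written 2 + r, so that it is visibly nonzero and τ p computes.
module Radix (r : ℕ) where

  p : ℕ
  p = 2 + r

  [t+y*p]/p≡y : ∀ {t} y → t < p → (t + y * p) / p ≡ y
  [t+y*p]/p≡y {t} y t<p = begin
    (t + y * p) / p      ≡⟨ +-distrib-/-∣ʳ t (n∣m*n y) ⟩
    t / p + y * p / p    ≡⟨ cong₂ _+_ (m<n⇒m/n≡0 t<p) (m*n/n≡m y p) ⟩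
    y                    ∎
    where open ≡-Reasoning

  [t+y*p]%p≡t : ∀ {t} y → t < p → (t + y * p) % p ≡ t
  [t+y*p]%p≡t {t} y t<p = trans ([m+kn]%n≡m%n t y p) (m<n⇒m%n≡m t<p)

  -- A digit sum c ≤ 2(p − 1) with c ≡ p − 1 (mod p) is p − 1 itself: no carry leaves it.
  digit-sum≡p∸1⇒no-carry : ∀ {c u v} → c + u * p ≡ (p ∸ 1) + v * p → c ≤ (p ∸ 1) + (p ∸ 1) → u ≡ v
  digit-sum≡p∸1⇒no-carry {c} {u} {v} eq c≤ with c <? p
  ... | yes c<p = begin
    u                          ≡⟨ [t+y*p]/p≡y u c<p ⟨
    (c + u * p) / p            ≡⟨ cong (_/ p) eq ⟩
    ((p ∸ 1) + v * p) / p      ≡⟨ [t+y*p]/p≡y v ≤-refl ⟩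
    v                          ∎
    where open ≡-Reasoning
  ... | no c≮p = ⊥-elim (<-irrefl c∸p≡p∸1 c∸p<p∸1)
    where
    p+[c∸p]≡c : p + (c ∸ p) ≡ c
    p+[c∸p]≡c = m+[n∸m]≡n (≮⇒≥ c≮p)
    c∸p<p∸1 : c ∸ p < p ∸ 1
    c∸p<p∸1 = +-cancelˡ-< (p ∸ 1) (c ∸ p) (p ∸ 1) (subst (_≤ (p ∸ 1) + (p ∸ 1)) (sym p+[c∸p]≡c) c≤)
    c∸p≡p∸1 : c ∸ p ≡ p ∸ 1
    c∸p≡p∸1 = begin
      c ∸ p                          ≡⟨ [t+y*p]%p≡t (suc u) (≤-trans c∸p<p∸1 (n≤1+n _)) ⟨
      ((c ∸ p) + suc u * p) % p      ≡⟨ cong (_% p) (trans (sym (+-assoc (c ∸ p) p (u * p)))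
                                          (cong (_+ u * p) (trans (+-comm (c ∸ p) p) p+[c∸p]≡c))) ⟩
      (c + u * p) % p                ≡⟨ cong (_% p) eq ⟩
      ((p ∸ 1) + v * p) % p          ≡⟨ [t+y*p]%p≡t v ≤-refl ⟩
      p ∸ 1                          ∎
      where open ≡-Reasoning

  repunit : ℕ → ℕ
  repunit zero    = 0
  repunit (suc j) = 1 + p * repunit j

  repunit-geometric : ∀ j → (p ∸ 1) * repunit j + 1 ≡ p ^ j
  repunit-geometric zero    = cong (_+ 1) (*-zeroʳ (p ∸ 1))
  repunit-geometric (suc j) = trans (step r (repunit j)) (cong (p *_) (repunit-geometric j))
    where
    step : ∀ r g → (1 + r) * (1 + (2 + r) * g) + 1 ≡ (2 + r) * ((1 + r) * g + 1)
    step = solve-∀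

  p^j∸1≡[p∸1]*repunit : ∀ j → p ^ j ∸ 1 ≡ (p ∸ 1) * repunit j
  p^j∸1≡[p∸1]*repunit j = trans (cong (_∸ 1) (sym (repunit-geometric j))) (m+n∸n≡m ((p ∸ 1) * repunit j) 1)

  repunit-quotient : ∀ k n K → K * (p ^ k ∸ 1) ≡ p ^ n ∸ 1 → K * repunit k ≡ repunit n
  repunit-quotient k n K K[p^k∸1]≡p^n∸1 = *-cancelˡ-≡ _ _ (p ∸ 1) (begin
    (p ∸ 1) * (K * repunit k)    ≡⟨ *-comm-left (p ∸ 1) K (repunit k) ⟩
    K * ((p ∸ 1) * repunit k)    ≡⟨ cong (K *_) (p^j∸1≡[p∸1]*repunit k) ⟨
    K * (p ^ k ∸ 1)              ≡⟨ K[p^k∸1]≡p^n∸1 ⟩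
    p ^ n ∸ 1                    ≡⟨ p^j∸1≡[p∸1]*repunit n ⟩
    (p ∸ 1) * repunit n          ∎)
    where
    open ≡-Reasoning
    *-comm-left : ∀ a b c → a * (b * c) ≡ b * (a * c)
    *-comm-left = solve-∀

  -- legendreFuel f n = ⌊n/p⌋ + ⌊n/p²⌋ + ⋯ + ⌊n/pᶠ⌋; the terms beyond f = n all vanish.
  legendreFuel : ℕ → ℕ → ℕ
  legendreFuel zero    n = 0
  legendreFuel (suc f) n = n / p + legendreFuel f (n / p)

  legendre : ℕ → ℕ
  legendre n = legendreFuel n n

  n≤1+f⇒n/p≤f : ∀ {n f} → n ≤ suc f → n / p ≤ f
  n≤1+f⇒n/p≤f {zero}  _      = z≤n
  n≤1+f⇒n/p≤f {suc n} n≤1+f = ≤-pred (≤-trans (m/n<m (suc n) p (s≤s (s≤s z≤n))) n≤1+f)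

  legendreFuel-irrelevant : ∀ {f g n} → n ≤ f → n ≤ g → legendreFuel f n ≡ legendreFuel g n
  legendreFuel-irrelevant {zero}  {zero}  _ _ = refl
  legendreFuel-irrelevant {zero}  {suc g} z≤n _ = legendreFuel-irrelevant {zero} {g} z≤n z≤n
  legendreFuel-irrelevant {suc f} {zero}  _ z≤n = legendreFuel-irrelevant {f} {zero} z≤n z≤n
  legendreFuel-irrelevant {suc f} {suc g} {n} n≤1+f n≤1+g =
    cong (n / p +_) (legendreFuel-irrelevant (n≤1+f⇒n/p≤f n≤1+f) (n≤1+f⇒n/p≤f n≤1+g))

  legendre-unfold : ∀ n → legendre n ≡ n / p + legendre (n / p)
  legendre-unfold zero    = refl
  legendre-unfold (suc n) =
    cong (suc n / p +_) (legendreFuel-irrelevant (n≤1+f⇒n/p≤f {suc n} ≤-refl) ≤-refl)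

  legendre-digit : ∀ {t} y → t < p → legendre (t + y * p) ≡ y + legendre y
  legendre-digit {t} y t<p = trans (legendre-unfold (t + y * p)) (cong (λ z → z + legendre z) ([t+y*p]/p≡y y t<p))

  legendre-p^*+ : ∀ j y {z} → z < p ^ j → legendre (p ^ j * y + z) ≡ y * repunit j + legendre y + legendre z
  legendre-p^*+ zero y {zero} _ = begin
    legendre (1 * y + 0)    ≡⟨ cong legendre (trans (+-identityʳ (1 * y)) (*-identityˡ y)) ⟩
    legendre y              ≡⟨ shift y (legendre y) ⟩
    y * 0 + legendre y + 0  ∎
    where
    open ≡-Reasoning
    shift : ∀ y l → l ≡ y * 0 + l + 0
    shift = solve-∀
  legendre-p^*+ zero y {suc z} (s≤s ())
  legendre-p^*+ (suc j) y {z} z<p^[1+j] = begin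
    legendre (p * p ^ j * y + z)                         ≡⟨ cong legendre split ⟩
    legendre (z % p + y′ * p)                            ≡⟨ legendre-digit y′ (m%n<n z p) ⟩
    y′ + legendre y′                                     ≡⟨ cong (y′ +_) (legendre-p^*+ j y z/p<p^j) ⟩
    y′ + (y * repunit j + legendre y + legendre (z / p))  ≡⟨ regroup (p ^ j * y) (z / p) (y * repunit j) (legendre y) _ ⟩
    (p ^ j * y + y * repunit j) + legendre y + (z / p + legendre (z / p))
      ≡⟨ cong₂ (λ u v → u + legendre y + v) leading-digits (sym (legendre-unfold z)) ⟩
    y * repunit (suc j) + legendre y + legendre z        ∎
    where
    open ≡-Reasoning
    y′ = p ^ j * y + z / p
    z/p<p^j : z / p < p ^ j
    z/p<p^j = m<n*o⇒m/o<n (subst (z <_) (*-comm p (p ^ j)) z<p^[1+j])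
    split : p * p ^ j * y + z ≡ z % p + y′ * p
    split = trans (cong (p * p ^ j * y +_) (m≡m%n+[m/n]*n z p)) (lemma p (p ^ j) y (z % p) (z / p))
      where
      lemma : ∀ p P y t u → p * P * y + (t + u * p) ≡ t + (P * y + u) * p
      lemma = solve-∀
    regroup : ∀ Y u G L M → (Y + u) + (G + L + M) ≡ (Y + G) + L + (u + M)
    regroup = solve-∀
    leading-digits : p ^ j * y + y * repunit j ≡ y * repunit (suc j)
    leading-digits = begin
      p ^ j * y + y * repunit j                              ≡⟨ cong (λ P → P * y + y * repunit j) (repunit-geometric j) ⟨
      ((p ∸ 1) * repunit j + 1) * y + y * repunit j          ≡⟨ lemma r (repunit j) y ⟩
      y * repunit (suc j)                                    ∎
      where
      lemma : ∀ r g y → ((1 + r) * g + 1) * y + y * g ≡ y * (1 + (2 + r) * g)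
      lemma = solve-∀

  legendre-p^* : ∀ j y → legendre (p ^ j * y) ≡ y * repunit j + legendre y
  legendre-p^* j y = begin
    legendre (p ^ j * y)                   ≡⟨ cong legendre (+-identityʳ (p ^ j * y)) ⟨
    legendre (p ^ j * y + 0)               ≡⟨ legendre-p^*+ j y (m^n>0 p j) ⟩
    y * repunit j + legendre y + 0         ≡⟨ +-identityʳ _ ⟩
    y * repunit j + legendre y             ∎
    where open ≡-Reasoning

  -- Every digit of a + b = pⁿ − 1 is p − 1, so the base-p addition of a and b has no carries.
  legendre-complement : ∀ n a b → a + b ≡ (p ∸ 1) * repunit n → legendre a + legendre b + n ≡ repunit n
  legendre-complement zero a b a+b≡0 =
    cong₂ (λ u v → legendre u + legendre v + 0) (m+n≡0⇒m≡0 a a+b≡0′) (m+n≡0⇒n≡0 a a+b≡0′)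
    where a+b≡0′ = trans a+b≡0 (*-zeroʳ (p ∸ 1))
  legendre-complement (suc n) a b a+b≡ = begin
    legendre a + legendre b + suc n
      ≡⟨ cong₂ (λ u v → u + v + suc n) (legendre-unfold a) (legendre-unfold b) ⟩
    (a / p + legendre (a / p)) + (b / p + legendre (b / p)) + suc n
      ≡⟨ regroup (a / p) (legendre (a / p)) (b / p) (legendre (b / p)) n ⟩
    (a / p + b / p) + (legendre (a / p) + legendre (b / p) + n) + 1
      ≡⟨ cong₂ (λ u v → u + v + 1) high-digits (legendre-complement n (a / p) (b / p) high-digits) ⟩
    (p ∸ 1) * repunit n + repunit n + 1
      ≡⟨ lemma r (repunit n) ⟩
    repunit (suc n) ∎
    where
    open ≡-Reasoning
    regroup : ∀ a La b Lb n → (a + La) + (b + Lb) + suc n ≡ (a + b) + (La + Lb + n) + 1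
    regroup = solve-∀
    lemma : ∀ r g → (1 + r) * g + g + 1 ≡ 1 + (2 + r) * g
    lemma = solve-∀
    digits : (a % p + b % p) + (a / p + b / p) * p ≡ (p ∸ 1) + ((p ∸ 1) * repunit n) * p
    digits = begin
      (a % p + b % p) + (a / p + b / p) * p          ≡⟨ shuffle (a % p) (a / p) (b % p) (b / p) p ⟩
      (a % p + a / p * p) + (b % p + b / p * p)      ≡⟨ cong₂ _+_ (m≡m%n+[m/n]*n a p) (m≡m%n+[m/n]*n b p) ⟨
      a + b                                          ≡⟨ a+b≡ ⟩
      (p ∸ 1) * repunit (suc n)                      ≡⟨ lemma′ r (repunit n) ⟩
      (p ∸ 1) + ((p ∸ 1) * repunit n) * p            ∎
      where
      shuffle : ∀ s a t b p → (s + t) + (a + b) * p ≡ (s + a * p) + (t + b * p)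
      shuffle = solve-∀
      lemma′ : ∀ r g → (1 + r) * (1 + (2 + r) * g) ≡ (1 + r) + ((1 + r) * g) * (2 + r)
      lemma′ = solve-∀
    high-digits : a / p + b / p ≡ (p ∸ 1) * repunit n
    high-digits = digit-sum≡p∸1⇒no-carry digits (+-mono-≤ (≤-pred (m%n<n a p)) (≤-pred (m%n<n b p)))

  t+y*p≤1+f⇒y≤f : ∀ {t y f} → t + y * p ≤ suc f → y ≤ f
  t+y*p≤1+f⇒y≤f {t} {zero}  _ = z≤n
  t+y*p≤1+f⇒y≤f {t} {suc y} t+y*p≤1+f = ≤-pred (begin
    suc (suc y)          ≤⟨ s≤s (s≤s (≤-trans (m≤m*n y p) (m≤n+m (y * p) r))) ⟩
    suc y * p            ≤⟨ m≤n+m (suc y * p) t ⟩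
    t + suc y * p        ≤⟨ t+y*p≤1+f ⟩
    suc _                ∎)
    where open ≤-Reasoning

  legendre-+-carriesAux : ∀ f c a b → c ≤ 1 → a + b + c ≤ f →
    legendre (a + b + c) ≡ legendre a + legendre b + carriesAux f p c a b
  legendre-+-carriesAux zero zero    zero    zero    _ _  = refl
  legendre-+-carriesAux zero c       (suc a) b       _ ()
  legendre-+-carriesAux zero c       zero    (suc b) _ ()
  legendre-+-carriesAux zero (suc c) zero    zero    _ ()
  legendre-+-carriesAux (suc f) c a b c≤1 a+b+c≤1+f = branch (p ≤ᵇ s) refl
    where
    s = a % p + b % p + c
    y = a / p + b / p

    -- c′ is the carry out of the lowest digit position, t the digit left there.
    with-carry-out : ∀ c′ t → t < p → s ≡ t + c′ * p → c′ ≤ 1 →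
      legendre (a + b + c) ≡ legendre a + legendre b + (c′ + carriesAux f p c′ (a / p) (b / p))
    with-carry-out c′ t t<p s≡ c′≤1 = begin
      legendre (a + b + c)                ≡⟨ cong legendre a+b+c≡ ⟩
      legendre (t + (y + c′) * p)         ≡⟨ legendre-digit (y + c′) t<p ⟩
      (y + c′) + legendre (y + c′)
        ≡⟨ cong ((y + c′) +_) (legendre-+-carriesAux f c′ (a / p) (b / p) c′≤1 y+c′≤f) ⟩
      (y + c′) + (legendre (a / p) + legendre (b / p) + X)
        ≡⟨ regroup (a / p) (b / p) c′ (legendre (a / p)) (legendre (b / p)) X ⟩
      (a / p + legendre (a / p)) + (b / p + legendre (b / p)) + (c′ + X)
        ≡⟨ cong₂ (λ u v → u + v + (c′ + X)) (legendre-unfold a) (legendre-unfold b) ⟨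
      legendre a + legendre b + (c′ + X)  ∎
      where
      open ≡-Reasoning
      X = carriesAux f p c′ (a / p) (b / p)
      regroup : ∀ a b c La Lb X → (a + b + c) + (La + Lb + X) ≡ (a + La) + (b + Lb) + (c + X)
      regroup = solve-∀
      a+b+c≡ : a + b + c ≡ t + (y + c′) * p
      a+b+c≡ = begin
        a + b + c
          ≡⟨ cong₂ (λ u v → u + v + c) (m≡m%n+[m/n]*n a p) (m≡m%n+[m/n]*n b p) ⟩
        (a % p + a / p * p) + (b % p + b / p * p) + c ≡⟨ shuffle (a % p) (a / p) (b % p) (b / p) c p ⟩
        s + y * p                                    ≡⟨ cong (_+ y * p) s≡ ⟩
        t + c′ * p + y * p                           ≡⟨ shuffle′ t c′ y p ⟩
        t + (y + c′) * p                             ∎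
        where
        shuffle : ∀ s a t b c p → (s + a * p) + (t + b * p) + c ≡ (s + t + c) + (a + b) * p
        shuffle = solve-∀
        shuffle′ : ∀ t c y p → t + c * p + y * p ≡ t + (y + c) * p
        shuffle′ = solve-∀
      y+c′≤f : y + c′ ≤ f
      y+c′≤f = t+y*p≤1+f⇒y≤f (subst (_≤ suc f) a+b+c≡ a+b+c≤1+f)

    branch : ∀ carry → (p ≤ᵇ s) ≡ carry →
      legendre (a + b + c) ≡ legendre a + legendre b
        + (if carry then suc (carriesAux f p 1 (a / p) (b / p)) else carriesAux f p 0 (a / p) (b / p))
    branch true  p≤ᵇs = with-carry-out 1 (s ∸ p) s∸p<p s≡[s∸p]+1*p ≤-refl
      where
      p≤s : p ≤ s
      p≤s = ≤ᵇ⇒≤ p s (subst T (sym p≤ᵇs) _)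
      s≡[s∸p]+1*p : s ≡ s ∸ p + 1 * p
      s≡[s∸p]+1*p = trans (sym (m∸n+n≡m p≤s)) (cong (s ∸ p +_) (sym (*-identityˡ p)))
      s∸p<p : s ∸ p < p
      s∸p<p = s≤s (+-cancelˡ-≤ p (s ∸ p) (p ∸ 1) (begin
        p + (s ∸ p)                          ≡⟨ m+[n∸m]≡n p≤s ⟩
        s                                    ≤⟨ +-mono-≤ (+-mono-≤ (≤-pred (m%n<n a p)) (≤-pred (m%n<n b p))) c≤1 ⟩
        (p ∸ 1) + (p ∸ 1) + 1                ≡⟨ +-comm (p ∸ 1 + (p ∸ 1)) 1 ⟩
        p + (p ∸ 1)                          ∎))
        where open ≤-Reasoning
    branch false p≰ᵇs = with-carry-out 0 s s<p (sym (+-identityʳ s)) z≤n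
      where
      s<p : s < p
      s<p = ≰⇒> (λ p≤s → subst T p≰ᵇs (≤⇒≤ᵇ p≤s))

  legendre-+ : ∀ a b → legendre (a + b) ≡ legendre a + legendre b + τ p a b
  legendre-+ a b = begin
    legendre (a + b)        ≡⟨ cong legendre (+-identityʳ (a + b)) ⟨
    legendre (a + b + 0)    ≡⟨ legendre-+-carriesAux (suc (a + b)) 0 a b z≤n
                                 (≤-trans (≤-reflexive (+-identityʳ (a + b))) (n≤1+n (a + b))) ⟩
    legendre a + legendre b + τ p a b ∎
    where open ≡-Reasoning

  legendre+τ-of-p^-multiple : ∀ k a b → a + b ≡ p ^ k * a → legendre b + τ p a b ≡ a * repunit k
  legendre+τ-of-p^-multiple k a b a+b≡ = +-cancelˡ-≡ (legendre a) _ _ (begin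
    legendre a + (legendre b + τ p a b)   ≡⟨ +-assoc (legendre a) (legendre b) (τ p a b) ⟨
    legendre a + legendre b + τ p a b     ≡⟨ legendre-+ a b ⟨
    legendre (a + b)                      ≡⟨ cong legendre a+b≡ ⟩
    legendre (p ^ k * a)                  ≡⟨ legendre-p^* k a ⟩
    a * repunit k + legendre a            ≡⟨ +-comm (a * repunit k) (legendre a) ⟩
    legendre a + a * repunit k            ∎)
    where open ≡-Reasoning

  -- With x = pⁿ − 1 = N − 1, A = x − S and B = x − T, x R has base-N digits S + T, A, B.
  legendre-[pⁿ∸1]*R : ∀ n {S T} → S < p ^ n → T < p ^ n →
    let R = (S + T + 1) * p ^ n + T + 1 in
    legendre ((p ∸ 1) * repunit n * R) + (n + n) ≡ repunit n * R + τ p S T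
  legendre-[pⁿ∸1]*R n {S} {T} S<N T<N = begin
    legendre (x * R) + (n + n)
      ≡⟨ cong (λ z → legendre z + (n + n)) xR≡ ⟩
    legendre (p ^ (n + n) * (S + T) + (N * A + B)) + (n + n)
      ≡⟨ cong (_+ (n + n)) (legendre-p^*+ (n + n) (S + T) NA+B<N²) ⟩
    (S + T) * repunit (n + n) + legendre (S + T) + legendre (N * A + B) + (n + n)
      ≡⟨ cong₂ (λ u v → (S + T) * repunit (n + n) + u + v + (n + n)) (legendre-+ S T) (legendre-p^*+ n A B<N) ⟩
    (S + T) * repunit (n + n) + (legendre S + legendre T + τ p S T) + (A * G + legendre A + legendre B) + (n + n)
      ≡⟨ regroup ((S + T) * repunit (n + n)) (legendre S) (legendre T) (τ p S T) (A * G) (legendre A) (legendre B) n ⟩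
    (S + T) * repunit (n + n) + A * G + τ p S T + (legendre S + legendre A + n) + (legendre T + legendre B + n)
      ≡⟨ cong₂ (λ u v → (S + T) * repunit (n + n) + A * G + τ p S T + u + v)
           (legendre-complement n S A S+A≡x) (legendre-complement n T B T+B≡x) ⟩
    (S + T) * repunit (n + n) + A * G + τ p S T + G + G
      ≡⟨ cong (λ g → (S + T) * g + A * G + τ p S T + G + G) repunit-double ⟩
    (S + T) * (G * (x + 2)) + A * G + τ p S T + G + G
      ≡⟨ collect (S + T) (x + 2) G A (τ p S T) ⟩
    G * ((S + T) * (x + 2) + A + 2) + τ p S T
      ≡⟨ cong (λ z → G * z + τ p S T) (R≡ S+A≡x x+1≡N) ⟨
    G * R + τ p S T ∎
    where
    open ≡-Reasoning
    N = p ^ n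
    G = repunit n
    x = (p ∸ 1) * G
    R = (S + T + 1) * N + T + 1
    x+1≡N : x + 1 ≡ N
    x+1≡N = repunit-geometric n
    <N⇒≤x : ∀ {y} → y < N → y ≤ x
    <N⇒≤x y<N = ≤-pred (subst (_ <_) (sym (trans (+-comm 1 x) x+1≡N)) y<N)
    A = x ∸ S
    B = x ∸ T
    S+A≡x : S + A ≡ x
    S+A≡x = m+[n∸m]≡n (<N⇒≤x S<N)
    T+B≡x : T + B ≡ x
    T+B≡x = m+[n∸m]≡n (<N⇒≤x T<N)
    ≤x⇒<N : ∀ {y} → y ≤ x → y < N
    ≤x⇒<N y≤x = subst (_ <_) (trans (+-comm 1 x) x+1≡N) (s≤s y≤x)
    A<N : A < N
    A<N = ≤x⇒<N (m∸n≤m x S)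
    B<N : B < N
    B<N = ≤x⇒<N (m∸n≤m x T)
    N*N≡p^[n+n] : N * N ≡ p ^ (n + n)
    N*N≡p^[n+n] = sym (^-distribˡ-+-* p n n)
    NA+B<N² : N * A + B < p ^ (n + n)
    NA+B<N² = subst (N * A + B <_) N*N≡p^[n+n] (<-≤-trans (+-monoʳ-< (N * A) B<N)
      (subst (_≤ N * N) (trans (*-suc N A) (+-comm N (N * A))) (*-monoʳ-≤ N A<N)))
    expansion : ∀ {x N} S A T B → S + A ≡ x → T + B ≡ x → x + 1 ≡ N →
      x * ((S + T + 1) * N + T + 1) ≡ N * N * (S + T) + (N * A + B)
    expansion S A T B refl T+B≡S+A refl = +-cancelʳ-≡ T _ _ (begin
      (S + A) * ((S + T + 1) * (S + A + 1) + T + 1) + T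
        ≡⟨ identity S A T ⟩
      (S + A + 1) * (S + A + 1) * (S + T) + (S + A + 1) * A + (S + A)
        ≡⟨ cong ((S + A + 1) * (S + A + 1) * (S + T) + (S + A + 1) * A +_) T+B≡S+A ⟨
      (S + A + 1) * (S + A + 1) * (S + T) + (S + A + 1) * A + (T + B)
        ≡⟨ reassoc ((S + A + 1) * (S + A + 1) * (S + T)) ((S + A + 1) * A) B T ⟩
      (S + A + 1) * (S + A + 1) * (S + T) + ((S + A + 1) * A + B) + T ∎)
      where
      identity : ∀ S A T → (S + A) * ((S + T + 1) * (S + A + 1) + T + 1) + T
                         ≡ (S + A + 1) * (S + A + 1) * (S + T) + (S + A + 1) * A + (S + A)
      identity = solve-∀
      reassoc : ∀ X Y B T → X + Y + (T + B) ≡ X + (Y + B) + T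
      reassoc = solve-∀
    xR≡ : x * R ≡ p ^ (n + n) * (S + T) + (N * A + B)
    xR≡ = trans (expansion S A T B S+A≡x T+B≡x x+1≡N) (cong (λ M → M * (S + T) + (N * A + B)) N*N≡p^[n+n])
    R≡ : ∀ {x N} → S + A ≡ x → x + 1 ≡ N → (S + T + 1) * N + T + 1 ≡ (S + T) * (x + 2) + A + 2
    R≡ refl refl = identity S A T
      where
      identity : ∀ S A T → (S + T + 1) * (S + A + 1) + T + 1 ≡ (S + T) * ((S + A) + 2) + A + 2
      identity = solve-∀
    repunit-double : repunit (n + n) ≡ G * (x + 2)
    repunit-double = *-cancelˡ-≡ _ _ (p ∸ 1) (+-cancelʳ-≡ 1 _ _ (begin
      (p ∸ 1) * repunit (n + n) + 1    ≡⟨ repunit-geometric (n + n) ⟩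
      p ^ (n + n)                      ≡⟨ N*N≡p^[n+n] ⟨
      N * N                            ≡⟨ cong (λ M → M * M) x+1≡N ⟨
      (x + 1) * (x + 1)                ≡⟨ square (p ∸ 1) G ⟩
      (p ∸ 1) * (G * (x + 2)) + 1      ∎))
      where
      square : ∀ q g → (q * g + 1) * (q * g + 1) ≡ q * (g * (q * g + 2)) + 1
      square = solve-∀
    regroup : ∀ D LS LT t AG LA LB n →
      D + (LS + LT + t) + (AG + LA + LB) + (n + n) ≡ D + AG + t + (LS + LA + n) + (LT + LB + n)
    regroup = solve-∀
    collect : ∀ D y g A t → D * (g * y) + A * g + t + g + g ≡ g * (D * y + A + 2) + t
    collect = solve-∀

  K*y+[p^n∸1]*y≡p^k*[K*y] : ∀ k n K y → K * repunit k ≡ repunit n →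
    K * y + (p ∸ 1) * repunit n * y ≡ p ^ k * (K * y)
  K*y+[p^n∸1]*y≡p^k*[K*y] k n K y K*Gk≡Gn = begin
    K * y + (p ∸ 1) * repunit n * y               ≡⟨ cong (λ g → K * y + (p ∸ 1) * g * y) K*Gk≡Gn ⟨
    K * y + (p ∸ 1) * (K * repunit k) * y         ≡⟨ factor (p ∸ 1) (repunit k) K y ⟩
    ((p ∸ 1) * repunit k + 1) * (K * y)           ≡⟨ cong (_* (K * y)) (repunit-geometric k) ⟩
    p ^ k * (K * y)                               ∎
    where
    open ≡-Reasoning
    factor : ∀ q g K y → K * y + q * (K * g) * y ≡ (q * g + 1) * (K * y)
    factor = solve-∀

  τ-sum-identity : ∀ k n S T K → S < p ^ n → T < p ^ n → K * repunit k ≡ repunit n →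
    let R = (S + T + 1) * p ^ n + T + 1 in
    τ p (K * R) ((p ∸ 1) * repunit n * R) + τ p S T ≡ n + n
  τ-sum-identity k n S T K S<N T<N K*Gk≡Gn = sym (+-cancelˡ-≡ (legendre b) _ _ (begin
    legendre b + (n + n)                  ≡⟨ legendre-[pⁿ∸1]*R n S<N T<N ⟩
    repunit n * R + τ p S T               ≡⟨ cong (λ g → g * R + τ p S T) K*Gk≡Gn ⟨
    K * repunit k * R + τ p S T           ≡⟨ cong (_+ τ p S T) (*-comm-middle K (repunit k) R) ⟩
    a * repunit k + τ p S T               ≡⟨ cong (_+ τ p S T) (legendre+τ-of-p^-multiple k a b a+b≡p^k*a) ⟨
    legendre b + τ p a b + τ p S T        ≡⟨ +-assoc (legendre b) (τ p a b) (τ p S T) ⟩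
    legendre b + (τ p a b + τ p S T)      ∎))
    where
    open ≡-Reasoning
    R = (S + T + 1) * p ^ n + T + 1
    a = K * R
    b = (p ∸ 1) * repunit n * R
    *-comm-middle : ∀ K g R → K * g * R ≡ K * R * g
    *-comm-middle = solve-∀
    a+b≡p^k*a : a + b ≡ p ^ k * a
    a+b≡p^k*a = K*y+[p^n∸1]*y≡p^k*[K*y] k n K R K*Gk≡Gn

  module PrimeBase (prime : Prime p) where

    record HasValuation (x e : ℕ) : Set where
      constructor valuation
      field
        unit       : ℕ
        x≡p^e*unit : x ≡ p ^ e * unit
        p∤unit     : ¬ p ∣ unit

    p∤1 : ¬ p ∣ 1
    p∤1 p∣1 with ∣1⇒≡1 p∣1
    ... | ()

    valuation-exists : ∀ x → x ≢ 0 → ∃ (HasValuation x)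
    valuation-exists = <-rec (λ x → x ≢ 0 → ∃ (HasValuation x)) step
      where
      step : ∀ x → (∀ {y} → y < x → y ≢ 0 → ∃ (HasValuation y)) → x ≢ 0 → ∃ (HasValuation x)
      step x rec x≢0 with p ∣? x
      ... | no p∤x = 0 , valuation x (sym (*-identityˡ x)) p∤x
      ... | yes (divides zero x≡0) = ⊥-elim (x≢0 x≡0)
      ... | yes (divides (suc y) x≡) with rec (subst (suc y <_) (sym x≡) (m<m*n (suc y) p (s≤s (s≤s z≤n)))) (λ ())
      ...   | e , valuation u 1+y≡ p∤u = suc e , valuation u (begin
        x                  ≡⟨ x≡ ⟩
        suc y * p          ≡⟨ cong (_* p) 1+y≡ ⟩
        p ^ e * u * p      ≡⟨ rotate (p ^ e) u p ⟩
        p * p ^ e * u      ∎) p∤u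
        where
        open ≡-Reasoning
        rotate : ∀ a u p → a * u * p ≡ p * a * u
        rotate = solve-∀

    p∣p^[1+e]*u : ∀ e u → p ∣ p ^ suc e * u
    p∣p^[1+e]*u e u = subst (p ∣_) (sym (*-assoc p (p ^ e) u)) (m∣m*n (p ^ e * u))

    valuation-unique : ∀ {x e f} → HasValuation x e → HasValuation x f → e ≡ f
    valuation-unique {e = e} {f} (valuation u x≡ p∤u) (valuation w x≡′ p∤w) =
      exponents-equal e f (trans (sym x≡) x≡′)
      where
      exponents-equal : ∀ e f → p ^ e * u ≡ p ^ f * w → e ≡ f
      exponents-equal zero    zero    _  = refl
      exponents-equal zero    (suc f) eq = ⊥-elim (p∤u (subst (p ∣_) (trans (sym eq) (*-identityˡ u)) (p∣p^[1+e]*u f w)))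
      exponents-equal (suc e) zero    eq = ⊥-elim (p∤w (subst (p ∣_) (trans eq (*-identityˡ w)) (p∣p^[1+e]*u e u)))
      exponents-equal (suc e) (suc f) eq = cong suc (exponents-equal e f (*-cancelˡ-≡ _ _ p (begin
        p * (p ^ e * u)   ≡⟨ *-assoc p (p ^ e) u ⟨
        p ^ suc e * u     ≡⟨ eq ⟩
        p ^ suc f * w     ≡⟨ *-assoc p (p ^ f) w ⟩
        p * (p ^ f * w)   ∎)))
        where open ≡-Reasoning

    valuation-* : ∀ {x y e f} → HasValuation x e → HasValuation y f → HasValuation (x * y) (e + f)
    valuation-* {x} {y} {e} {f} (valuation u x≡ p∤u) (valuation w y≡ p∤w) = valuation (u * w) xy≡ p∤uw
      where
      xy≡ : x * y ≡ p ^ (e + f) * (u * w)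
      xy≡ = begin
        x * y                        ≡⟨ cong₂ _*_ x≡ y≡ ⟩
        p ^ e * u * (p ^ f * w)      ≡⟨ interchange (p ^ e) u (p ^ f) w ⟩
        p ^ e * p ^ f * (u * w)      ≡⟨ cong (_* (u * w)) (^-distribˡ-+-* p e f) ⟨
        p ^ (e + f) * (u * w)        ∎
        where
        open ≡-Reasoning
        interchange : ∀ a b c d → a * b * (c * d) ≡ a * c * (b * d)
        interchange = solve-∀
      p∤uw : ¬ p ∣ u * w
      p∤uw p∣uw with euclidsLemma u w prime p∣uw
      ... | inj₁ p∣u = p∤u p∣u
      ... | inj₂ p∣w = p∤w p∣w

    valuation-p^ : ∀ e → HasValuation (p ^ e) e
    valuation-p^ e = valuation 1 (sym (*-identityʳ (p ^ e))) p∤1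

    valuation-p : HasValuation p 1
    valuation-p = subst (λ x → HasValuation x 1) (*-identityʳ p) (valuation-p^ 1)

    valuation⇒≢0 : ∀ {x e} → HasValuation x e → x ≢ 0
    valuation⇒≢0 {e = e} (valuation u x≡ p∤u) x≡0 = p∤u (subst (p ∣_) (sym u≡0) (p ∣0))
      where
      u≡0 : u ≡ 0
      u≡0 = m*n≡0⇒m≡0 u (p ^ e) {{m^n≢0 p e}} (trans (*-comm u (p ^ e)) (trans (sym x≡) x≡0))

    p^e∣⇒e≤valuation : ∀ {x v e} → HasValuation x v → p ^ e ∣ x → e ≤ v
    p^e∣⇒e≤valuation {x} {v} {e} x∶v (divides k x≡k*p^e) =
      subst (e ≤_) (valuation-unique x∶f+e x∶v) (m≤n+m e f)
      where
      k≢0 : k ≢ 0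
      k≢0 k≡0 = valuation⇒≢0 x∶v (trans x≡k*p^e (cong (_* p ^ e) k≡0))
      f = proj₁ (valuation-exists k k≢0)
      x∶f+e : HasValuation x (f + e)
      x∶f+e = subst (λ z → HasValuation z (f + e)) (sym x≡k*p^e)
                (valuation-* (proj₂ (valuation-exists k k≢0)) (valuation-p^ e))

    e≤valuation⇒p^e∣ : ∀ {x v e} → HasValuation x v → e ≤ v → p ^ e ∣ x
    e≤valuation⇒p^e∣ {x} {v} {e} (valuation u x≡ _) e≤v = divides (p ^ (v ∸ e) * u) (begin
      x                          ≡⟨ x≡ ⟩
      p ^ v * u                  ≡⟨ cong (λ d → p ^ d * u) (m∸n+n≡m {v} {e} e≤v) ⟨
      p ^ (v ∸ e + e) * u        ≡⟨ cong (_* u) (^-distribˡ-+-* p (v ∸ e) e) ⟩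
      p ^ (v ∸ e) * p ^ e * u    ≡⟨ swap (p ^ (v ∸ e)) (p ^ e) u ⟩
      p ^ (v ∸ e) * u * p ^ e    ∎)
      where
      open ≡-Reasoning
      swap : ∀ a b c → a * b * c ≡ a * c * b
      swap = solve-∀

    legendre-suc : ∀ n {e} → HasValuation (suc n) e → legendre (suc n) ≡ legendre n + e
    legendre-suc = <-rec (λ n → ∀ {e} → HasValuation (suc n) e → legendre (suc n) ≡ legendre n + e) step
      where
      step : ∀ n → (∀ {m} → m < n → ∀ {e} → HasValuation (suc m) e → legendre (suc m) ≡ legendre m + e) →
             ∀ {e} → HasValuation (suc n) e → legendre (suc n) ≡ legendre n + e
      step n rec {e} 1+n∶e with p ∣? suc n
      ... | no p∤1+n = begin
        legendre (suc n)                        ≡⟨ cong (λ z → legendre (suc z)) (m≡m%n+[m/n]*n n p) ⟩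
        legendre (suc (n % p) + n / p * p)      ≡⟨ legendre-digit (n / p) 1+n%p<p ⟩
        n / p + legendre (n / p)                ≡⟨ legendre-unfold n ⟨
        legendre n                              ≡⟨ +-identityʳ (legendre n) ⟨
        legendre n + 0                          ≡⟨ cong (legendre n +_) (valuation-unique 1+n∶0 1+n∶e) ⟩
        legendre n + e                          ∎
        where
        open ≡-Reasoning
        1+n∶0 : HasValuation (suc n) 0
        1+n∶0 = valuation (suc n) (sym (*-identityˡ (suc n))) p∤1+n
        1+n%p<p : suc (n % p) < p
        1+n%p<p = s≤s (≤∧≢⇒< (≤-pred (m%n<n n p)) λ n%p≡p∸1 →
          p∤1+n (divides (suc (n / p)) (cong suc (trans (m≡m%n+[m/n]*n n p) (cong (_+ n / p * p) n%p≡p∸1)))))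
      ... | yes (divides (suc w) 1+n≡1+w*p) = begin
        legendre (suc n)                        ≡⟨ cong legendre 1+n≡1+w*p ⟩
        legendre (0 + suc w * p)                ≡⟨ legendre-digit (suc w) (s≤s z≤n) ⟩
        suc w + legendre (suc w)                ≡⟨ cong (suc w +_) (rec w<n 1+w∶f) ⟩
        suc w + (legendre w + f)                ≡⟨ regroup w (legendre w) f ⟩
        (w + legendre w) + (f + 1)              ≡⟨ cong₂ _+_ (legendre-digit w ≤-refl) (valuation-unique 1+n∶e 1+n∶f+1) ⟨
        legendre ((p ∸ 1) + w * p) + e          ≡⟨ cong (λ m → legendre m + e) n≡p∸1+w*p ⟨
        legendre n + e                          ∎
        where
        open ≡-Reasoning
        n≡p∸1+w*p : n ≡ (p ∸ 1) + w * p
        n≡p∸1+w*p = suc-injective 1+n≡1+w*p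
        w<n : w < n
        w<n = subst (w <_) (sym n≡p∸1+w*p) (s≤s (≤-trans (m≤m*n w p) (m≤n+m (w * p) r)))
        f = proj₁ (valuation-exists (suc w) (λ ()))
        1+w∶f : HasValuation (suc w) f
        1+w∶f = proj₂ (valuation-exists (suc w) (λ ()))
        1+n∶f+1 : HasValuation (suc n) (f + 1)
        1+n∶f+1 = subst (λ m → HasValuation m (f + 1)) (sym 1+n≡1+w*p) (valuation-* 1+w∶f valuation-p)
        regroup : ∀ w L f → suc w + (L + f) ≡ (w + L) + (f + 1)
        regroup = solve-∀

    legendre-formula : ∀ n → HasValuation (n !) (legendre n)
    legendre-formula zero    = valuation 1 refl p∤1
    legendre-formula (suc n) = subst (HasValuation (suc n !)) legendre-step (valuation-* 1+n∶e (legendre-formula n))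
      where
      e = proj₁ (valuation-exists (suc n) (λ ()))
      1+n∶e : HasValuation (suc n) e
      1+n∶e = proj₂ (valuation-exists (suc n) (λ ()))
      legendre-step : e + legendre n ≡ legendre (suc n)
      legendre-step = trans (+-comm e (legendre n)) (sym (legendre-suc n 1+n∶e))

    kummer : ∀ a b → HasValuation ((a + b) C a) (τ p a b)
    kummer a b = subst (HasValuation ((a + b) C a)) g≡τ C∶g
      where
      n = a + b
      a≤n : a ≤ n
      a≤n = m≤m+n a b
      d = a ! * (n ∸ a) !
      instance _ = a !* (n ∸ a) !≢0
      C*d≡n! : (n C a) * d ≡ n !
      C*d≡n! = trans (cong (_* d) (nCk≡n!/k![n-k]! a≤n)) (m/n*n≡m (k![n∸k]!∣n! a≤n))
      C≢0 : n C a ≢ 0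
      C≢0 C≡0 = ≢-nonZero⁻¹ (n !) {{n !≢0}} (trans (sym C*d≡n!) (cong (_* d) C≡0))
      g = proj₁ (valuation-exists (n C a) C≢0)
      C∶g : HasValuation (n C a) g
      C∶g = proj₂ (valuation-exists (n C a) C≢0)
      d∶ : HasValuation d (legendre a + legendre b)
      d∶ = subst (λ m → HasValuation (a ! * m !) (legendre a + legendre b)) (sym (m+n∸m≡n a b))
             (valuation-* (legendre-formula a) (legendre-formula b))
      n!∶ : HasValuation (n !) (g + (legendre a + legendre b))
      n!∶ = subst (λ m → HasValuation m (g + (legendre a + legendre b))) C*d≡n! (valuation-* C∶g d∶)
      g≡τ : g ≡ τ p a b
      g≡τ = +-cancelˡ-≡ (legendre a + legendre b) g (τ p a b) (begin
        legendre a + legendre b + g       ≡⟨ +-comm (legendre a + legendre b) g ⟩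
        g + (legendre a + legendre b)     ≡⟨ valuation-unique n!∶ (legendre-formula n) ⟩
        legendre n                        ≡⟨ legendre-+ a b ⟩
        legendre a + legendre b + τ p a b ∎)
        where open ≡-Reasoning

    binomial-divisibility : ∀ k n S T K → S < p ^ n → T < p ^ n → K * (p ^ k ∸ 1) ≡ p ^ n ∸ 1 →
      let R = (S + T + 1) * p ^ n + T + 1 in
      (τ p S T ≡ 0) ⇔ (p ^ n * p ^ n ∣ ((p ^ k * K * R) C (K * R)))
    binomial-divisibility k n S T K S<N T<N K[p^k∸1]≡p^n∸1 = mk⇔ no-carries⇒N²∣ N²∣⇒no-carries
      where
      R = (S + T + 1) * p ^ n + T + 1
      b = (p ∸ 1) * repunit n * R
      K*Gk≡Gn = repunit-quotient k n K K[p^k∸1]≡p^n∸1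
      binom = (p ^ k * K * R) C (K * R)
      C∶τ : HasValuation binom (τ p (K * R) b)
      C∶τ = subst (λ m → HasValuation (m C (K * R)) (τ p (K * R) b))
              (trans (K*y+[p^n∸1]*y≡p^k*[K*y] k n K R K*Gk≡Gn) (sym (*-assoc (p ^ k) K R))) (kummer (K * R) b)
      τ+τ≡n+n : τ p (K * R) b + τ p S T ≡ n + n
      τ+τ≡n+n = τ-sum-identity k n S T K S<N T<N K*Gk≡Gn
      p^[n+n]≡N*N : p ^ (n + n) ≡ p ^ n * p ^ n
      p^[n+n]≡N*N = ^-distribˡ-+-* p n n
      no-carries⇒N²∣ : τ p S T ≡ 0 → p ^ n * p ^ n ∣ binom
      no-carries⇒N²∣ τST≡0 = subst (_∣ binom) p^[n+n]≡N*N (e≤valuation⇒p^e∣ C∶τ (≤-reflexive (begin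
        n + n                            ≡⟨ τ+τ≡n+n ⟨
        τ p (K * R) b + τ p S T          ≡⟨ cong (τ p (K * R) b +_) τST≡0 ⟩
        τ p (K * R) b + 0                ≡⟨ +-identityʳ _ ⟩
        τ p (K * R) b                    ∎)))
        where open ≡-Reasoning
      N²∣⇒no-carries : p ^ n * p ^ n ∣ binom → τ p S T ≡ 0
      N²∣⇒no-carries N²∣binom = n≤0⇒n≡0 (+-cancelˡ-≤ (τ p (K * R) b) _ 0 (begin
        τ p (K * R) b + τ p S T          ≡⟨ τ+τ≡n+n ⟩
        n + n                            ≤⟨ p^e∣⇒e≤valuation C∶τ (subst (_∣ binom) (sym p^[n+n]≡N*N) N²∣binom) ⟩
        τ p (K * R) b                    ≡⟨ +-identityʳ _ ⟨
        τ p (K * R) b + 0                ∎))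
        where open ≤-Reasoning

lemma2p2 : (p P N S T K : ℕ) → Prime p → P ∈↑ p → 1 < P → N ∈↑ P →
    S < N → T < N → K * (P ∸ 1) ≡ N ∸ 1 →
    let R = (S + T + 1) * N + T + 1 in
    (τ p S T ≡ 0) ⇔ (N * N ∣ ((P * K * R) C (K * R)))
lemma2p2 zero          P N S T K p-prime = ⊥-elim (¬prime[0] p-prime)
lemma2p2 (suc zero)    P N S T K p-prime = ⊥-elim (¬prime[1] p-prime)
lemma2p2 (suc (suc r)) P N S T K p-prime (k , refl) _ (m , refl) =
  subst (λ N → S < N → T < N → K * (p ^ k ∸ 1) ≡ N ∸ 1 →
               let R = (S + T + 1) * N + T + 1 in (τ p S T ≡ 0) ⇔ (N * N ∣ ((p ^ k * K * R) C (K * R))))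
        (sym (^-*-assoc p k m)) (binomial-divisibility k (k * m) S T K)
  where open Radix r; open PrimeBase p-prime
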